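{- For every graph $G$ and all positive integers $n$ and $t$, $\pi_t^*(K_n\Box G)\le \pi_t^*(K_{n+1}\Box G)$.
   Context: Graphs are finite simple graphs. A distribution on a graph $G=(V,E)$ is a function $D:V\to\mathbb{N}$, with size $|D|=\sum_v D(v)$. A pebbling move removes two pebbles from a vertex having at least two pebbles and places one pebble on a neighbor. A distribution $D$ is $t$-solvable if for every vertex $v$, some sequence of pebbling moves starting from $D$ results in a distribution with at least $t$ pebbles on $v$. The optimal $t$-pebbling number $\pi_t^*(G)$ is the minimum size of a $t$-solvable distribution on $G$. $K_n$ is the complete graph on $n$ vertices and $\Box$ is the Cartesian product of graphs. -}

module Defs where

open import Data.Nat using (ℕ; _+_; _∸_; _≤_)
open import Data.Bool using (Bool; true; false; not; _∧_; _∨_)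
open import Data.Fin using (Fin)
open import Data.Fin.Properties using (*↔×)
import Data.Fin.Properties as FinP
open import Data.Product using (Σ; ∃; ∃-syntax; _×_; _,_; proj₁; proj₂)
open import Data.List using (List; map; allFin)
open import Data.Nat.ListAction using (sum)
open import Function using (_∘_)
open import Data.Product.Function.NonDependent.Propositional using (_×-↔_)
open import Function.Bundles using (_↔_; Inverse)
open import Relation.Binary.PropositionalEquality using (_≡_; refl; cong; sym; trans)
open import Relation.Binary.Definitions using (DecidableEquality)
open import Relation.Nullary using (yes; no)
open import Relation.Nullary.Decidable using (⌊_⌋; map′)
open import Relation.Binary.Construct.Closure.ReflexiveTransitive using (Star)

record Graph : Set₁ where
  field
    V     : Set
    order : ℕ
    enum  : Fin order ↔ V
    adj   : V → V → Bool
    adj-sym    : ∀ u v → adj u v ≡ adj v u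
    adj-irrefl : ∀ v → adj v v ≡ false

open Graph public

vertex-≟ : (G : Graph) → DecidableEquality (V G)
vertex-≟ G u v = map′ (λ p → trans (sym (Inverse.strictlyInverseˡ (enum G) u))
                                   (trans (cong (Inverse.to (enum G)) p)
                                          (Inverse.strictlyInverseˡ (enum G) v)))
                      (cong (Inverse.from (enum G)))
                      (Inverse.from (enum G) u FinP.≟ Inverse.from (enum G) v)

K : ℕ → Graph
K n = record
  { V = Fin n ; order = n ; enum = Function.Properties.Inverse.refl _ ; adj = λ i j → not ⌊ i FinP.≟ j ⌋
  ; adj-sym = λ i j → sym-lemma i j ; adj-irrefl = λ i → irr i }
  where
  import Function.Properties.Inverse
  sym-lemma : (i j : Fin n) → not ⌊ i FinP.≟ j ⌋ ≡ not ⌊ j FinP.≟ i ⌋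
  sym-lemma i j with i FinP.≟ j | j FinP.≟ i
  ... | yes _ | yes _ = refl
  ... | no _  | no _  = refl
  ... | yes p | no q  = Data.Empty.⊥-elim (q (sym p)) where import Data.Empty
  ... | no p  | yes q = Data.Empty.⊥-elim (p (sym q)) where import Data.Empty
  irr : (i : Fin n) → not ⌊ i FinP.≟ i ⌋ ≡ false
  irr i with i FinP.≟ i
  ... | yes _ = refl
  ... | no ¬p = Data.Empty.⊥-elim (¬p refl) where import Data.Empty

_□_ : Graph → Graph → Graph
G □ H = record
  { V = V G × V H
  ; order = order G Data.Nat.* order H
  ; enum = Function.Properties.Inverse.↔-trans *↔× (enum G ×-↔ enum H)
  ; adj = λ { (g , h) (g′ , h′) →
        (⌊ vertex-≟ G g g′ ⌋ ∧ adj H h h′) ∨ (⌊ vertex-≟ H h h′ ⌋ ∧ adj G g g′) }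
  ; adj-sym = λ { (g , h) (g′ , h′) → symm g g′ h h′ }
  ; adj-irrefl = λ { (g , h) → irr g h }
  }
  where
  import Function.Properties.Inverse
  import Data.Nat
  open import Data.Empty using (⊥-elim)
  symm : ∀ g g′ h h′ →
    ((⌊ vertex-≟ G g g′ ⌋ ∧ adj H h h′) ∨ (⌊ vertex-≟ H h h′ ⌋ ∧ adj G g g′)) ≡
    ((⌊ vertex-≟ G g′ g ⌋ ∧ adj H h′ h) ∨ (⌊ vertex-≟ H h′ h ⌋ ∧ adj G g′ g))
  symm g g′ h h′ rewrite adj-sym H h h′ | adj-sym G g g′
    with vertex-≟ G g g′ | vertex-≟ G g′ g | vertex-≟ H h h′ | vertex-≟ H h′ h
  ... | yes _ | yes _ | yes _ | yes _ = refl
  ... | yes _ | yes _ | no _  | no _  = refl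
  ... | no _  | no _  | yes _ | yes _ = refl
  ... | no _  | no _  | no _  | no _  = refl
  ... | yes p | no q  | _ | _ = ⊥-elim (q (sym p))
  ... | no p  | yes q | _ | _ = ⊥-elim (p (sym q))
  ... | _ | _ | yes p | no q  = ⊥-elim (q (sym p))
  ... | _ | _ | no p  | yes q = ⊥-elim (p (sym q))
  irr : ∀ g h → ((⌊ vertex-≟ G g g ⌋ ∧ adj H h h) ∨ (⌊ vertex-≟ H h h ⌋ ∧ adj G g g)) ≡ false
  irr g h rewrite adj-irrefl H h | adj-irrefl G g
    with vertex-≟ G g g | vertex-≟ H h h
  ... | yes _ | yes _ = refl
  ... | yes _ | no _  = refl
  ... | no _  | yes _ = refl
  ... | no _  | no _  = refl

Distribution : Graph → Set
Distribution G = V G → ℕ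

size : (G : Graph) → Distribution G → ℕ
size G D = sum (map (D ∘ Inverse.to (enum G)) (allFin (order G)))

PebblingMove : (G : Graph) → Distribution G → Distribution G → Set
PebblingMove G D D′ =
  Σ (V G) λ u → Σ (V G) λ w →
    (adj G u w ≡ true) × (2 ≤ D u) ×
    (∀ x → D′ x ≡ (D x ∸ (if ⌊ vertex-≟ G x u ⌋ then 2 else 0))
                       + (if ⌊ vertex-≟ G x w ⌋ then 1 else 0))
  where open import Data.Bool using (if_then_else_)

Reachable : (G : Graph) → Distribution G → Distribution G → Set
Reachable G = Star (PebblingMove G)

Solvable : (G : Graph) → ℕ → Distribution G → Set
Solvable G t D = ∀ v → Σ (Distribution G) λ D′ → Reachable G D D′ × (t ≤ D′ v)

IsOptimalPebblingNumber : (G : Graph) → ℕ → ℕ → Set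
IsOptimalPebblingNumber G t p =
  (Σ (Distribution G) λ D → Solvable G t D × size G D ≡ p) ×
  (∀ D → Solvable G t D → p ≤ size G D)

-- Merging two of the n + 1 copies of G in K (n + 1) □ G maps it onto K n □ G,
-- sending every edge to an edge or to a single vertex.  Pushing a distribution
-- forward along this map keeps its size, and each pebbling move upstairs is
-- shadowed by at most one move downstairs: a move along a collapsed edge only
-- loses a pebble, any other move is mirrored along the image edge.  So the
-- push-forward of an optimal t-solvable distribution on K (n + 1) □ G is a
-- t-solvable distribution on K n □ G of the same size.

module Submission where

open import Defs
open import Data.Bool using (Bool; true; false; _∧_; if_then_else_)
open import Data.Bool.Properties using (∨-zeroʳ)
open import Data.Fin using (Fin; zero; suc; _↑ˡ_; _↑ʳ_; remQuot)
import Data.Fin.Properties as FinP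
open import Data.List using (map; tabulate)
open import Data.Nat using (ℕ; zero; suc; _+_; _*_; _∸_; _≤_; z≤n; s≤s)
open import Data.Nat.ListAction using (sum)
open import Data.Nat.Properties
open import Algebra.Properties.CommutativeMonoid.Sum +-0-commutativeMonoid
  using (∑-distrib-+; sum-cong-≗) renaming (sum to ∑)
open import Algebra.Properties.CommutativeSemigroup +-commutativeSemigroup
  using (xy∙z≈xz∙y; interchange)
open import Data.Product using (Σ; ∃; _×_; _,_; map₁)
open import Data.Product.Properties using (,-injective)
open import Data.Sum using (_⊎_; inj₁; inj₂)
open import Function using (_∘_)
open import Function.Bundles using (Inverse)
open import Relation.Binary.Construct.Closure.ReflexiveTransitive using (ε; _◅_; _◅◅_)
open import Relation.Binary.PropositionalEquality
open import Relation.Nullary using (Dec; yes; no; does)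
open import Relation.Nullary.Decidable using (⌊_⌋; dec-true; dec-false; isYes≗does; map′; _×-dec_)
open import Relation.Nullary.Negation using (contradiction)

sum-map-tabulate : ∀ {A : Set} {n} (f : Fin n → A) (h : A → ℕ) →
  sum (map h (tabulate f)) ≡ ∑ (h ∘ f)
sum-map-tabulate {n = zero} f h = refl
sum-map-tabulate {n = suc n} f h = cong (h (f zero) +_) (sum-map-tabulate (f ∘ suc) h)

∑-↑ : ∀ k {l} (f : Fin (k + l) → ℕ) → ∑ f ≡ ∑ (f ∘ (_↑ˡ l)) + ∑ (f ∘ (k ↑ʳ_))
∑-↑ zero f = refl
∑-↑ (suc k) f = trans (cong (f zero +_) (∑-↑ k (f ∘ suc))) (sym (+-assoc (f zero) _ _))

∑-remQuot : ∀ m {n} (f : Fin m × Fin n → ℕ) →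
  ∑ (f ∘ remQuot {m} n) ≡ ∑ (λ i → ∑ (λ j → f (i , j)))
∑-remQuot zero f = refl
∑-remQuot (suc m) {n} f = begin
  ∑ (f ∘ remQuot n)
    ≡⟨ ∑-↑ n _ ⟩
  ∑ (f ∘ remQuot n ∘ (_↑ˡ m * n)) + ∑ (f ∘ remQuot n ∘ (n ↑ʳ_))
    ≡⟨ cong₂ _+_ (sum-cong-≗ first) (sum-cong-≗ rest) ⟩
  ∑ (λ j → f (zero , j)) + ∑ (f ∘ map₁ suc ∘ remQuot n)
    ≡⟨ cong (∑ (λ j → f (zero , j)) +_) (∑-remQuot m (f ∘ map₁ suc)) ⟩
  ∑ (λ i → ∑ (λ j → f (i , j))) ∎
  where
  open ≡-Reasoning
  first : ∀ j → f (remQuot {suc m} n (j ↑ˡ m * n)) ≡ f (zero , j)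
  first j rewrite FinP.splitAt-↑ˡ n j (m * n) = refl
  rest : ∀ x → f (remQuot {suc m} n (n ↑ʳ x)) ≡ f (map₁ suc (remQuot n x))
  rest x rewrite FinP.splitAt-↑ʳ n (m * n) x = refl

size-□ : ∀ G H (D : Distribution (G □ H)) →
  size (G □ H) D ≡ ∑ (λ i → ∑ (λ j → D (Inverse.to (enum G) i , Inverse.to (enum H) j)))
size-□ G H D =
  trans (sum-map-tabulate {n = order (G □ H)} (λ i → i) (D ∘ Inverse.to (enum (G □ H))))
        (∑-remQuot (order G) (λ (i , j) → D (Inverse.to (enum G) i , Inverse.to (enum H) j)))

-- Written exactly as in PebblingMove, so that moves can be built with refl.
singleton : (X : Graph) → V X → ℕ → Distribution X
singleton X u k x = if ⌊ vertex-≟ X x u ⌋ then k else 0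

does-unique : ∀ {A : Set} (a? b? : Dec A) → does a? ≡ does b?
does-unique a? (yes a) = dec-true a? a
does-unique a? (no ¬a) = dec-false a? ¬a

module _ (X : Graph) {u : V X} {k : ℕ} where

  singleton-≡ : ∀ {x} (x≟u : Dec (x ≡ u)) → singleton X u k x ≡ (if does x≟u then k else 0)
  singleton-≡ {x} x≟u = cong (if_then k else 0)
    (trans (isYes≗does (vertex-≟ X x u)) (does-unique (vertex-≟ X x u) x≟u))

  singleton-self : singleton X u k u ≡ k
  singleton-self = singleton-≡ (yes refl)

  singleton-≤ : {D : Distribution X} → k ≤ D u → ∀ x → singleton X u k x ≤ D x
  singleton-≤ k≤Du x with vertex-≟ X x u
  ... | yes refl = k≤Du
  ... | no _     = z≤n

singleton-mono : ∀ (X : Graph) {u k l} → k ≤ l → ∀ x → singleton X u k x ≤ singleton X u l x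
singleton-mono X {u} k≤l x = if-mono ⌊ vertex-≟ X x u ⌋
  where
  if-mono : ∀ b → (if b then _ else 0) ≤ (if b then _ else 0)
  if-mono true  = k≤l
  if-mono false = z≤n

-- Stated with does rather than ⌊_⌋: does reduces through map′, so for K n the
-- right-hand side computes on Fin constructors.
singleton-□ : ∀ G H g h k g′ h′ → singleton (G □ H) (g , h) k (g′ , h′) ≡
  (if does (vertex-≟ G g′ g) ∧ does (vertex-≟ H h′ h) then k else 0)
singleton-□ G H g h k g′ h′ = singleton-≡ (G □ H)
  (map′ (λ (p , q) → cong₂ _,_ p q) ,-injective (vertex-≟ G g′ g ×-dec vertex-≟ H h′ h))

module _ (X : Graph) {D D′ : Distribution X} where

  source target : PebblingMove X D D′ → V X
  source (u , _) = u
  target (_ , w , _) = w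

  move-adj : (m : PebblingMove X D D′) → adj X (source m) (target m) ≡ true
  move-adj (_ , _ , uw , _) = uw

  move-balance : (m : PebblingMove X D D′) → ∀ x →
    D′ x + singleton X (source m) 2 x ≡ D x + singleton X (target m) 1 x
  move-balance (u , w , _ , 2≤Du , D′≡) x = begin
    D′ x + s         ≡⟨ cong (_+ s) (D′≡ x) ⟩
    D x ∸ s + t + s  ≡⟨ xy∙z≈xz∙y (D x ∸ s) t s ⟩
    D x ∸ s + s + t  ≡⟨ cong (_+ t) (m∸n+n≡m (singleton-≤ X 2≤Du x)) ⟩
    D x + t          ∎
    where
    open ≡-Reasoning
    s = singleton X u 2 x
    t = singleton X w 1 x

module _ (G H : Graph) {g g′ : V G} {h h′ : V H} where

  □-adj⇒ : adj (G □ H) (g , h) (g′ , h′) ≡ true →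
    (g ≡ g′ × adj H h h′ ≡ true) ⊎ (h ≡ h′ × adj G g g′ ≡ true)
  □-adj⇒ e with vertex-≟ G g g′ | vertex-≟ H h h′ | adj H h h′ | adj G g g′
  ... | yes g≡g′ | _          | true | _    = inj₁ (g≡g′ , refl)
  ... | _        | yes h≡h′   | _    | true = inj₂ (h≡h′ , refl)
  □-adj⇒ () | yes _ | no _  | false | _
  □-adj⇒ () | no _  | yes _ | _     | false
  □-adj⇒ () | no _  | no _  | _     | _

  □-adj⇐ : (g ≡ g′ × adj H h h′ ≡ true) ⊎ (h ≡ h′ × adj G g g′ ≡ true) →
    adj (G □ H) (g , h) (g′ , h′) ≡ true
  □-adj⇐ (inj₁ (refl , hh′)) with vertex-≟ G g g
  ... | yes _   rewrite hh′ = refl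
  ... | no g≢g  = contradiction refl g≢g
  □-adj⇐ (inj₂ (refl , gg′)) with vertex-≟ H h h
  ... | yes _   rewrite gg′ = ∨-zeroʳ _
  ... | no h≢h  = contradiction refl h≢h

K-adj : ∀ {n} {i j : Fin n} → i ≢ j → adj (K n) i j ≡ true
K-adj {i = i} {j} i≢j rewrite isYes≗does (i FinP.≟ j) | dec-false (i FinP.≟ j) i≢j = refl

-- φ sends every edge of B to an edge of S or collapses it to a vertex, and
-- push D x stands for the number of pebbles D places on the fibre of x.
record Contraction (B S : Graph) : Set where
  field
    φ : V B → V S
    φ-surjective : ∀ x → ∃ λ y → φ y ≡ x
    φ-adj : ∀ {u w} → adj B u w ≡ true → φ u ≢ φ w → adj S (φ u) (φ w) ≡ true
    push : Distribution B → Distribution S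
    push-cong : ∀ {D D₁} → (∀ y → D y ≡ D₁ y) → ∀ x → push D x ≡ push D₁ x
    push-+ : ∀ D D₁ x → push (λ y → D y + D₁ y) x ≡ push D x + push D₁ x
    push-singleton : ∀ u k x → push (singleton B u k) x ≡ singleton S (φ u) k x
    push-≥ : ∀ D y → D y ≤ push D (φ y)

  _⊑_ : Distribution S → Distribution S → Set
  E ⊑ E′ = ∀ x → E x ≤ E′ x

  push-balance : ∀ {D D′} (m : PebblingMove B D D′) x →
    push D′ x + singleton S (φ (source B m)) 2 x ≡ push D x + singleton S (φ (target B m)) 1 x
  push-balance {D} {D′} m x = begin
    push D′ x + singleton S (φ u) 2 x         ≡⟨ cong (push D′ x +_) (push-singleton u 2 x) ⟨
    push D′ x + push (singleton B u 2) x      ≡⟨ push-+ D′ (singleton B u 2) x ⟨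
    push (λ y → D′ y + singleton B u 2 y) x   ≡⟨ push-cong (move-balance B m) x ⟩
    push (λ y → D y + singleton B w 1 y) x    ≡⟨ push-+ D (singleton B w 1) x ⟩
    push D x + push (singleton B w 1) x       ≡⟨ cong (push D x +_) (push-singleton w 1 x) ⟩
    push D x + singleton S (φ w) 1 x          ∎
    where
    open ≡-Reasoning
    u = source B m
    w = target B m

  -- A move along a collapsed edge only loses a pebble downstairs; any other
  -- move is mirrored by the move along the image edge.
  simulate-move : ∀ {D D′ E} → PebblingMove B D D′ → push D ⊑ E →
    Σ (Distribution S) λ E′ → Reachable S E E′ × push D′ ⊑ E′
  simulate-move {D} {D′} {E} m D⊑E with vertex-≟ S (φ (source B m)) (φ (target B m))
  ... | yes ū≡w̄ = E , ε , λ x → ≤-trans (+-cancelʳ-≤ _ _ _ (shrinks x)) (D⊑E x)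
    where
    open ≤-Reasoning
    ū = φ (source B m)
    shrinks : ∀ x → push D′ x + singleton S ū 2 x ≤ push D x + singleton S ū 2 x
    shrinks x = begin
      push D′ x + singleton S ū 2 x                ≡⟨ push-balance m x ⟩
      push D x + singleton S (φ (target B m)) 1 x  ≡⟨ cong (λ v → push D x + singleton S v 1 x) ū≡w̄ ⟨
      push D x + singleton S ū 1 x                 ≤⟨ +-monoʳ-≤ (push D x) (singleton-mono S (s≤s z≤n) x) ⟩
      push D x + singleton S ū 2 x                 ∎
  ... | no ū≢w̄ = E′ , move ◅ ε , D′⊑E′
    where
    open ≤-Reasoning
    ū = φ (source B m)
    w̄ = φ (target B m)
    E′ : Distribution S
    E′ x = E x ∸ singleton S ū 2 x + singleton S w̄ 1 x
    2≤Eū : 2 ≤ E ū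
    2≤Eū = begin
      2                                  ≤⟨ m≤n+m 2 (push D′ ū) ⟩
      push D′ ū + 2                      ≡⟨ cong (push D′ ū +_) (singleton-self S) ⟨
      push D′ ū + singleton S ū 2 ū      ≡⟨ push-balance m ū ⟩
      push D ū + singleton S w̄ 1 ū       ≡⟨ cong (push D ū +_) (singleton-≡ S (no ū≢w̄)) ⟩
      push D ū + 0                       ≡⟨ +-identityʳ (push D ū) ⟩
      push D ū                           ≤⟨ D⊑E ū ⟩
      E ū                                ∎
    move : PebblingMove S E E′
    move = ū , w̄ , φ-adj (move-adj B m) ū≢w̄ , 2≤Eū , λ _ → refl
    D′⊑E′ : push D′ ⊑ E′
    D′⊑E′ x = +-cancelʳ-≤ _ _ _ (begin
      push D′ x + singleton S ū 2 x   ≡⟨ push-balance m x ⟩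
      push D x + singleton S w̄ 1 x    ≤⟨ +-monoˡ-≤ _ (D⊑E x) ⟩
      E x + singleton S w̄ 1 x         ≡⟨ move-balance S move x ⟨
      E′ x + singleton S ū 2 x        ∎)

  simulate : ∀ {D D′ E} → Reachable B D D′ → push D ⊑ E →
    Σ (Distribution S) λ E′ → Reachable S E E′ × push D′ ⊑ E′
  simulate ε D⊑E = _ , ε , D⊑E
  simulate (m ◅ ms) D⊑E with simulate-move m D⊑E
  ... | E₁ , E↝E₁ , D₁⊑E₁ with simulate ms D₁⊑E₁
  ... | E′ , E₁↝E′ , D′⊑E′ = E′ , E↝E₁ ◅◅ E₁↝E′ , D′⊑E′

  push-solvable : ∀ {t D} → Solvable B t D → Solvable S t (push D)
  push-solvable solvable x with φ-surjective x
  ... | y , refl with solvable y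
  ... | D′ , D↝D′ , t≤D′y with simulate D↝D′ (λ _ → ≤-refl)
  ... | E′ , E↝E′ , D′⊑E′ = E′ , E↝E′ , ≤-trans t≤D′y (≤-trans (push-≥ D′ y) (D′⊑E′ (φ y)))

module LayerMerge (G : Graph) (n : ℕ) where

  B S : Graph
  B = K (suc (suc n)) □ G
  S = K (suc n) □ G

  merge : Fin (suc (suc n)) → Fin (suc n)
  merge zero    = zero
  merge (suc a) = a

  collapse : V B → V S
  collapse (a , g) = merge a , g

  push : Distribution B → Distribution S
  push D (zero  , g) = D (zero , g) + D (suc zero , g)
  push D (suc a , g) = D (suc (suc a) , g)

  collapse-adj : ∀ {u w} → adj B u w ≡ true → collapse u ≢ collapse w →
    adj S (collapse u) (collapse w) ≡ true
  collapse-adj {_ , g} e ne with □-adj⇒ (K _) G e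
  ... | inj₁ (refl , gh) = □-adj⇐ (K _) G (inj₁ (refl , gh))
  ... | inj₂ (refl , _)  = □-adj⇐ (K _) G (inj₂ (refl , K-adj (ne ∘ cong (_, g))))

  push-cong : ∀ {D D₁} → (∀ y → D y ≡ D₁ y) → ∀ x → push D x ≡ push D₁ x
  push-cong D≗D₁ (zero  , g) = cong₂ _+_ (D≗D₁ _) (D≗D₁ _)
  push-cong D≗D₁ (suc a , g) = D≗D₁ _

  push-+ : ∀ D D₁ x → push (λ y → D y + D₁ y) x ≡ push D x + push D₁ x
  push-+ D D₁ (zero  , g) = interchange (D (zero , g)) (D₁ (zero , g)) _ _
  push-+ D D₁ (suc a , g) = refl

  push-≥ : ∀ D y → D y ≤ push D (collapse y)
  push-≥ D (zero , g)        = m≤m+n _ _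
  push-≥ D (suc zero , g)    = m≤n+m _ _
  push-≥ D (suc (suc a) , g) = ≤-refl

  push-singleton : ∀ u k x → push (singleton B u k) x ≡ singleton S (collapse u) k x
  push-singleton (a , h) k (b , g) = on-layer b
    where
    open ≡-Reasoning
    pebbles-if : Bool → ℕ
    pebbles-if c = if c ∧ does (vertex-≟ G g h) then k else 0
    bottom-layers : ∀ a → pebbles-if (does (zero FinP.≟ a)) + pebbles-if (does (suc zero FinP.≟ a))
                          ≡ pebbles-if (does (zero FinP.≟ merge a))
    bottom-layers zero          = +-identityʳ _
    bottom-layers (suc zero)    = refl
    bottom-layers (suc (suc a)) = refl
    upper-layer : ∀ b a → does (suc (suc b) FinP.≟ a) ≡ does (suc b FinP.≟ merge a)
    upper-layer b zero          = refl
    upper-layer b (suc zero)    = refl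
    upper-layer b (suc (suc a)) = refl
    on-layer : ∀ b → push (singleton B (a , h) k) (b , g) ≡ singleton S (merge a , h) k (b , g)
    on-layer zero = begin
      singleton B (a , h) k (zero , g) + singleton B (a , h) k (suc zero , g)
        ≡⟨ cong₂ _+_ (singleton-□ (K _) G a h k zero g) (singleton-□ (K _) G a h k (suc zero) g) ⟩
      pebbles-if (does (zero FinP.≟ a)) + pebbles-if (does (suc zero FinP.≟ a))
        ≡⟨ bottom-layers a ⟩
      pebbles-if (does (zero FinP.≟ merge a))
        ≡⟨ singleton-□ (K _) G (merge a) h k zero g ⟨
      singleton S (merge a , h) k (zero , g) ∎
    on-layer (suc b) = begin
      singleton B (a , h) k (suc (suc b) , g)  ≡⟨ singleton-□ (K _) G a h k (suc (suc b)) g ⟩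
      pebbles-if (does (suc (suc b) FinP.≟ a)) ≡⟨ cong pebbles-if (upper-layer b a) ⟩
      pebbles-if (does (suc b FinP.≟ merge a)) ≡⟨ singleton-□ (K _) G (merge a) h k (suc b) g ⟨
      singleton S (merge a , h) k (suc b , g)  ∎

  layer-merge : Contraction B S
  layer-merge = record
    { φ              = collapse
    ; φ-surjective   = λ (a , g) → (suc a , g) , refl
    ; φ-adj          = collapse-adj
    ; push           = push
    ; push-cong      = push-cong
    ; push-+         = push-+
    ; push-singleton = push-singleton
    ; push-≥         = push-≥
    }

  size-push : ∀ D → size S (push D) ≡ size B D
  size-push D = begin
    size S (push D)
      ≡⟨ size-□ (K _) G (push D) ⟩
    ∑ (λ j → layer zero j + layer (suc zero) j) + upper-layers
      ≡⟨ cong (_+ upper-layers) (∑-distrib-+ (layer zero) (layer (suc zero))) ⟩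
    ∑ (layer zero) + ∑ (layer (suc zero)) + upper-layers
      ≡⟨ +-assoc (∑ (layer zero)) _ _ ⟩
    ∑ (layer zero) + (∑ (layer (suc zero)) + upper-layers)
      ≡⟨ size-□ (K _) G D ⟨
    size B D ∎
    where
    open ≡-Reasoning
    layer : Fin (suc (suc n)) → Fin (order G) → ℕ
    layer a j = D (a , Inverse.to (enum G) j)
    upper-layers : ℕ
    upper-layers = ∑ (λ a → ∑ (layer (suc (suc a))))

proposition3p4 : (G : Graph) (n t : ℕ) → 1 ≤ n → 1 ≤ t → (p q : ℕ) →
    IsOptimalPebblingNumber (K n □ G) t p →
    IsOptimalPebblingNumber (K (suc n) □ G) t q →
    p ≤ q
proposition3p4 G (suc n) _ _ _ p q (_ , p-minimal) ((D , D-solvable , size-D≡q) , _) = begin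
  p               ≤⟨ p-minimal (push D) (push-solvable D-solvable) ⟩
  size S (push D) ≡⟨ size-push D ⟩
  size B D        ≡⟨ size-D≡q ⟩
  q               ∎
  where
  open ≤-Reasoning
  open LayerMerge G n
  open Contraction layer-merge using (push-solvable)
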